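{- Let $D$ be a connected locally finite C-homogeneous digraph such that $N^+(x)$ and $N^-(x)$ are independent sets for all $x\in VD$. If the directed triangle $C_3$ embeds into $D$, then $d^+(x)=d^-(x)$ for all $x\in VD$.
   Context: A digraph has an irreflexive antisymmetric edge relation; connectedness refers to the underlying undirected graph. $D$ is C-homogeneous if every isomorphism between finite connected induced subdigraphs extends to an automorphism of $D$. $N^+(x)=\{y: xy\in ED\}$, $N^-(x)=\{y: yx\in ED\}$, $d^+(x)=|N^+(x)|$, $d^-(x)=|N^-(x)|$; independent means no two vertices adjacent. -}

module Defs where

open import Data.Nat using (ℕ)
open import Data.Fin using (Fin)
open import Data.Product using (Σ; ∃; _×_; _,_)
open import Data.Sum using (_⊎_)
open import Data.List using (List; length)
open import Data.List.Membership.Propositional using (_∈_)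
open import Data.List.Relation.Unary.Unique.Propositional using (Unique)
open import Relation.Nullary using (¬_)
open import Relation.Binary.PropositionalEquality using (_≡_)
open import Function.Bundles using (_⇔_; _↔_; Inverse)

record Digraph : Set₁ where
  field
    V      : Set
    E      : V → V → Set
    irrefl : ∀ x → ¬ E x x
    antisym : ∀ x y → E x y → ¬ E y x

module _ (D : Digraph) where
  open Digraph D

  Adj : V → V → Set
  Adj x y = E x y ⊎ E y x

  data Walk : V → V → Set where
    here : ∀ {x} → Walk x x
    step : ∀ {x y z} → Adj x y → Walk y z → Walk x z

  Connected : Set
  Connected = ∀ x y → Walk x y

  record LocallyFinite : Set where
    field
      outs      : V → List V
      outs-uniq : ∀ x → Unique (outs x)
      outs-spec : ∀ x y → (y ∈ outs x) ⇔ E x y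
      ins       : V → List V
      ins-uniq  : ∀ x → Unique (ins x)
      ins-spec  : ∀ x y → (y ∈ ins x) ⇔ E y x

  outdeg : LocallyFinite → V → ℕ
  outdeg lf x = length (LocallyFinite.outs lf x)

  indeg : LocallyFinite → V → ℕ
  indeg lf x = length (LocallyFinite.ins lf x)

  -- A finite vertex set listed injectively as xs : Fin n → V.
  InjectiveList : ∀ {n} → (Fin n → V) → Set
  InjectiveList {n} xs = ∀ (i j : Fin n) → xs i ≡ xs j → i ≡ j

  data WalkIn {n} (xs : Fin n → V) : Fin n → Fin n → Set where
    here : ∀ {i} → WalkIn xs i i
    step : ∀ {i j k} → Adj (xs i) (xs j) → WalkIn xs j k → WalkIn xs i k

  ConnectedIn : ∀ {n} → (Fin n → V) → Set
  ConnectedIn {n} xs = ∀ (i j : Fin n) → WalkIn xs i j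

  IsIsoIn : ∀ {n} → (Fin n → V) → (Fin n → V) → Set
  IsIsoIn {n} xs ys = ∀ (i j : Fin n) → E (xs i) (xs j) ⇔ E (ys i) (ys j)

  IsAutomorphism : (V ↔ V) → Set
  IsAutomorphism σ = ∀ x y → E x y ⇔ E (Inverse.to σ x) (Inverse.to σ y)

  CHomogeneous : Set
  CHomogeneous = ∀ (n : ℕ) (xs ys : Fin n → V) →
    InjectiveList xs → InjectiveList ys →
    ConnectedIn xs → ConnectedIn ys → IsIsoIn xs ys →
    Σ (V ↔ V) λ σ → IsAutomorphism σ × (∀ i → Inverse.to σ (xs i) ≡ ys i)

  OutIndependent : Set
  OutIndependent = ∀ x y z → E x y → E x z → ¬ E y z

  InIndependent : Set
  InIndependent = ∀ x y z → E y x → E z x → ¬ E y z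

  -- the directed triangle C₃ embeds (as induced subdigraph; inducedness and
  -- distinctness are automatic by irreflexivity and antisymmetry)
  C₃Embeds : Set
  C₃Embeds = ∃ λ a → ∃ λ b → ∃ λ c → E a b × E b c × E c a

module Submission where

-- For an arc p → q write Apex(p,q) for the set of vertices c
-- closing a directed triangle on it (q → c → p).  C-homogeneity applied to
-- the connected two-vertex subdigraph {p, q} shows that Aut(D) is transitive
-- on arcs, so |Apex(p,q)| is a constant t; and t ≥ 1 because C₃ embeds.
-- Counting the directed triangles through a vertex x once by their
-- out-neighbour of x and once by their in-neighbour of x gives
-- d⁺(x)·t = d⁻(x)·t, hence d⁺(x) = d⁻(x).
--
-- The edge relation need not be decidable, so the finite sets Apex(p,q) can
-- only be enumerated under double negation; the conclusion, an equation of
-- natural numbers, is stable under double negation.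

open import Defs
open import Level using (0ℓ)
open import Data.Nat using (ℕ; suc; _+_; _*_; _≤_; z≤n; s≤s; NonZero; _≟_)
open import Data.Nat.Properties using (≤-antisym; *-cancelʳ-≡)
open import Data.Fin using (Fin; zero; suc)
open import Data.Product using (Σ; _×_; _,_; proj₁; swap)
open import Data.Sum using (inj₁; inj₂)
open import Data.Empty using (⊥-elim)
open import Data.List using (List; []; _∷_; length; map; _++_)
open import Data.List.Properties using (length-map; length-++; length-removeAt′)
open import Data.List.Membership.Propositional using (_∈_)
open import Data.List.Membership.Propositional.Properties using (∈-++⁺ˡ; ∈-++⁺ʳ; ∈-++⁻; ∈-map⁺; ∈-map⁻)
open import Data.List.Relation.Unary.Any using (here; there; index; _─_)
open import Data.List.Relation.Unary.All as All using (All; []; _∷_)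
open import Data.List.Relation.Unary.AllPairs using ([]; _∷_)
open import Data.List.Relation.Unary.Unique.Propositional using (Unique)
import Data.List.Relation.Unary.Unique.Propositional.Properties as Unique
open import Relation.Binary.PropositionalEquality using (_≡_; _≢_; refl; sym; trans; cong₂; subst; module ≡-Reasoning)
open import Relation.Nullary using (¬_; Dec; yes; no)
open import Relation.Nullary.Decidable using (decidable-stable; ¬¬-excluded-middle)
open import Relation.Nullary.Negation using (¬¬-Monad)
open import Effect.Monad using (RawMonad)
open import Function using (_∘_)
open import Function.Definitions using (Injective)
open import Function.Bundles using (_↔_; Inverse; Injection; Equivalence; mk⇔)
open import Function.Properties.Inverse using (Inverse⇒Injection)

open RawMonad (¬¬-Monad {a = 0ℓ}) using (pure; _>>=_)

record Enumerates {A : Set} (P : A → Set) (L : List A) : Set where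
  field
    unique   : Unique L
    sound    : ∀ {a} → a ∈ L → P a
    complete : ∀ {a} → P a → a ∈ L

_↪_ : {A B : Set} → (A → Set) → (B → Set) → Set
_↪_ {A} {B} P Q = Σ (A → B) λ f → Injective _≡_ _≡_ f × (∀ {a} → P a → Q (f a))

swap-injective : {A B : Set} → Injective _≡_ _≡_ (swap {A = A} {B = B})
swap-injective {x = _ , _} {y = _ , _} refl = refl

member⇒nonZero : ∀ {A : Set} {a : A} {L : List A} → a ∈ L → NonZero (length L)
member⇒nonZero (here _)  = _
member⇒nonZero (there _) = _

∈-─ : ∀ {A : Set} {b c : A} (ys : List A) (p : b ∈ ys) → c ∈ ys → c ≢ b → c ∈ (ys ─ p)
∈-─ (y ∷ ys) (here refl) (here refl) c≢b = ⊥-elim (c≢b refl)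
∈-─ (y ∷ ys) (here refl) (there c∈ys) _   = c∈ys
∈-─ (y ∷ ys) (there p)   (here refl) _    = here refl
∈-─ (y ∷ ys) (there p)   (there c∈ys) c≢b = there (∈-─ ys p c∈ys c≢b)

injection-≤ : ∀ {A B : Set} {xs : List A} {ys : List B} (f : A → B) →
  Injective _≡_ _≡_ f → Unique xs → (∀ {a} → a ∈ xs → f a ∈ ys) →
  length xs ≤ length ys
injection-≤ {xs = []} f f-inj _ _ = z≤n
injection-≤ {xs = a ∷ xs} {ys} f f-inj (a∉xs ∷ xs-unique) f[xs]⊆ys =
  subst (suc (length xs) ≤_) (sym (length-removeAt′ ys (index fa∈ys)))
    (s≤s (injection-≤ f f-inj xs-unique f[xs]⊆ys─fa))
  where
  fa∈ys : f a ∈ ys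
  fa∈ys = f[xs]⊆ys (here refl)
  f[xs]⊆ys─fa : ∀ {a′} → a′ ∈ xs → f a′ ∈ (ys ─ fa∈ys)
  f[xs]⊆ys─fa {a′} a′∈xs = ∈-─ ys fa∈ys (f[xs]⊆ys (there a′∈xs))
    (λ fa′≡fa → All.lookup a∉xs a′∈xs (sym (f-inj fa′≡fa)))

enumeration-≤ : ∀ {A B : Set} {P : A → Set} {Q : B → Set} {L₁ L₂} →
  Enumerates P L₁ → Enumerates Q L₂ → P ↪ Q → length L₁ ≤ length L₂
enumeration-≤ e₁ e₂ (f , f-inj , f-maps) =
  injection-≤ f f-inj (Enumerates.unique e₁)
    (Enumerates.complete e₂ ∘ f-maps ∘ Enumerates.sound e₁)

enumeration-≡ : ∀ {A B : Set} {P : A → Set} {Q : B → Set} {L₁ L₂} →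
  Enumerates P L₁ → Enumerates Q L₂ → P ↪ Q → Q ↪ P → length L₁ ≡ length L₂
enumeration-≡ e₁ e₂ P↪Q Q↪P =
  ≤-antisym (enumeration-≤ e₁ e₂ P↪Q) (enumeration-≤ e₂ e₁ Q↪P)

module _ {A : Set} {P : A → Set} where

  filterBy : (L : List A) → All (Dec ∘ P) L → List A
  filterBy []      []           = []
  filterBy (a ∷ L) (yes _ ∷ ds) = a ∷ filterBy L ds
  filterBy (a ∷ L) (no _ ∷ ds)  = filterBy L ds

  filterBy-sound : ∀ {c} (L : List A) (ds : All (Dec ∘ P) L) →
    c ∈ filterBy L ds → c ∈ L × P c
  filterBy-sound (a ∷ L) (yes pa ∷ ds) (here refl) = here refl , pa
  filterBy-sound (a ∷ L) (yes _ ∷ ds)  (there c∈) =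
    let c∈L , pc = filterBy-sound L ds c∈ in there c∈L , pc
  filterBy-sound (a ∷ L) (no _ ∷ ds)   c∈ =
    let c∈L , pc = filterBy-sound L ds c∈ in there c∈L , pc

  filterBy-complete : ∀ {c} (L : List A) (ds : All (Dec ∘ P) L) →
    c ∈ L → P c → c ∈ filterBy L ds
  filterBy-complete (a ∷ L) (yes _ ∷ ds) (here refl) _  = here refl
  filterBy-complete (a ∷ L) (no ¬pa ∷ ds) (here refl) pc = ⊥-elim (¬pa pc)
  filterBy-complete (a ∷ L) (yes _ ∷ ds) (there c∈L) pc = there (filterBy-complete L ds c∈L pc)
  filterBy-complete (a ∷ L) (no _ ∷ ds)  (there c∈L) pc = filterBy-complete L ds c∈L pc

  filterBy-unique : (L : List A) (ds : All (Dec ∘ P) L) → Unique L → Unique (filterBy L ds)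
  filterBy-unique []      []           []                  = []
  filterBy-unique (a ∷ L) (yes _ ∷ ds) (a∉L ∷ L-unique) =
    All.tabulate (λ c∈ → All.lookup a∉L (proj₁ (filterBy-sound L ds c∈)))
      ∷ filterBy-unique L ds L-unique
  filterBy-unique (a ∷ L) (no _ ∷ ds)  (_ ∷ L-unique)   = filterBy-unique L ds L-unique

¬¬-all : {A : Set} {R : A → Set} → (∀ a → ¬ ¬ R a) → (L : List A) → ¬ ¬ All R L
¬¬-all ¬¬r []      = pure []
¬¬-all ¬¬r (a ∷ L) = ¬¬r a >>= λ r → ¬¬-all ¬¬r L >>= λ rs → pure (r ∷ rs)

-- A finite enumeration of Q can be refined to one of {a | Q a, P a}, without
-- deciding P: it suffices to decide it on the listed elements, which is
-- possible under double negation.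
¬¬-refine : {A : Set} {Q : A → Set} {L : List A} → Enumerates Q L →
  (P : A → Set) → ¬ ¬ Σ (List A) (Enumerates (λ a → Q a × P a))
¬¬-refine {L = L} e P =
  ¬¬-all (λ _ → ¬¬-excluded-middle) L >>= λ ds → pure (filterBy L ds , record
    { unique   = filterBy-unique L ds (Enumerates.unique e)
    ; sound    = λ c∈ → let c∈L , pc = filterBy-sound L ds c∈ in Enumerates.sound e c∈L , pc
    ; complete = λ (qc , pc) → filterBy-complete L ds (Enumerates.complete e qc) pc
    })

Total : {A B : Set} → (A → Set) → (A → B → Set) → A × B → Set
Total Base Fibre (a , b) = Base a × Fibre a b

module _ {A B : Set} {Fibre : A → B → Set} where

  Fibres : List A → Set
  Fibres = All (λ a → Σ (List B) (Enumerates (Fibre a)))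

  totalSpace : (L : List A) → Fibres L → List (A × B)
  totalSpace []      []             = []
  totalSpace (a ∷ L) ((K , _) ∷ fs) = map (a ,_) K ++ totalSpace L fs

  totalSpace-sound : ∀ {a b} (L : List A) (fs : Fibres L) →
    (a , b) ∈ totalSpace L fs → a ∈ L × Fibre a b
  totalSpace-sound (a ∷ L) ((K , eK) ∷ fs) ab∈ with ∈-++⁻ (map (a ,_) K) ab∈
  ... | inj₁ ab∈aK with ∈-map⁻ (a ,_) ab∈aK
  ...   | b , b∈K , refl = here refl , Enumerates.sound eK b∈K
  totalSpace-sound (a ∷ L) (_ ∷ fs) _ | inj₂ ab∈rest =
    let a∈L , fab = totalSpace-sound L fs ab∈rest in there a∈L , fab

  totalSpace-complete : ∀ {a b} (L : List A) (fs : Fibres L) →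
    a ∈ L → Fibre a b → (a , b) ∈ totalSpace L fs
  totalSpace-complete (a ∷ L) ((K , eK) ∷ fs) (here refl) fab =
    ∈-++⁺ˡ (∈-map⁺ (a ,_) (Enumerates.complete eK fab))
  totalSpace-complete (a ∷ L) ((K , _) ∷ fs) (there a∈L) fab =
    ∈-++⁺ʳ (map (_ ,_) K) (totalSpace-complete L fs a∈L fab)

  -- Distinct base points contribute disjoint blocks of pairs.
  totalSpace-unique : (L : List A) (fs : Fibres L) → Unique L → Unique (totalSpace L fs)
  totalSpace-unique []      []              []               = []
  totalSpace-unique (a ∷ L) ((K , eK) ∷ fs) (a∉L ∷ L-unique) =
    Unique.++⁺ (Unique.map⁺ (λ { refl → refl }) (Enumerates.unique eK))
      (totalSpace-unique L fs L-unique) disjoint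
    where
    disjoint : ∀ {ab} → ¬ (ab ∈ map (a ,_) K × ab ∈ totalSpace L fs)
    disjoint (ab∈aK , ab∈rest) with ∈-map⁻ (a ,_) ab∈aK
    ... | _ , _ , refl = All.lookup a∉L (proj₁ (totalSpace-sound L fs ab∈rest)) refl

  totalSpace-enumerates : ∀ {Base L} → Enumerates Base L → (fs : Fibres L) →
    Enumerates (Total Base Fibre) (totalSpace L fs)
  totalSpace-enumerates {L = L} eL fs = record
    { unique   = totalSpace-unique L fs (Enumerates.unique eL)
    ; sound    = λ { {_ , _} ab∈ → let a∈L , fab = totalSpace-sound L fs ab∈
                                   in Enumerates.sound eL a∈L , fab }
    ; complete = λ { {_ , _} (ba , fab) → totalSpace-complete L fs (Enumerates.complete eL ba) fab }
    }

  totalSpace-length : (t : ℕ) (L : List A) (fs : Fibres L) →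
    (∀ {a K} → a ∈ L → Enumerates (Fibre a) K → length K ≡ t) →
    length (totalSpace L fs) ≡ length L * t
  totalSpace-length t []      []              _      = refl
  totalSpace-length t (a ∷ L) ((K , eK) ∷ fs) size-t =
    trans (length-++ (map (a ,_) K))
      (cong₂ _+_ (trans (length-map (a ,_) K) (size-t (here refl) eK))
                 (totalSpace-length t L fs (size-t ∘ there)))

module _ (D : Digraph) where
  open Digraph D

  Apex : V → V → V → Set
  Apex p q c = E q c × E c p

  arcList : V → V → Fin 2 → V
  arcList p q zero       = p
  arcList p q (suc zero) = q

  arcList-injective : ∀ {p q} → E p q → InjectiveList D (arcList p q)
  arcList-injective _   zero       zero       _   = refl
  arcList-injective {p} pq zero       (suc zero) refl = ⊥-elim (irrefl p pq)
  arcList-injective {p} pq (suc zero) zero       refl = ⊥-elim (irrefl p pq)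
  arcList-injective _   (suc zero) (suc zero) _   = refl

  arcList-connected : ∀ {p q} → E p q → ConnectedIn D (arcList p q)
  arcList-connected pq zero       zero       = here
  arcList-connected pq zero       (suc zero) = step (inj₁ pq) here
  arcList-connected pq (suc zero) zero       = step (inj₂ pq) here
  arcList-connected pq (suc zero) (suc zero) = here

  arcList-iso : ∀ {p q r s} → E p q → E r s → IsIsoIn D (arcList p q) (arcList r s)
  arcList-iso {p} {q} {r} {s} pq rs zero zero =
    mk⇔ (⊥-elim ∘ irrefl p) (⊥-elim ∘ irrefl r)
  arcList-iso pq rs zero (suc zero) =
    mk⇔ (λ _ → rs) (λ _ → pq)
  arcList-iso {p} {q} {r} {s} pq rs (suc zero) zero =
    mk⇔ (⊥-elim ∘ antisym p q pq) (⊥-elim ∘ antisym r s rs)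
  arcList-iso {p} {q} {r} {s} pq rs (suc zero) (suc zero) =
    mk⇔ (⊥-elim ∘ irrefl q) (⊥-elim ∘ irrefl s)

  arc-transitive : CHomogeneous D → ∀ {p q r s} → E p q → E r s →
    Σ (V ↔ V) λ σ → IsAutomorphism D σ ×
      (∀ i → Inverse.to σ (arcList p q i) ≡ arcList r s i)
  arc-transitive ch pq rs =
    ch 2 _ _ (arcList-injective pq) (arcList-injective rs)
      (arcList-connected pq) (arcList-connected rs) (arcList-iso pq rs)

  apex-↪ : CHomogeneous D → ∀ {p q r s} → E p q → E r s → Apex p q ↪ Apex r s
  apex-↪ ch {p} {q} {r} {s} pq rs with arc-transitive ch pq rs
  ... | σ , σ-aut , σ-maps = to , Injection.injective (Inverse⇒Injection σ) , apex↦apex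
    where
    open Inverse σ using (to)
    apex↦apex : ∀ {c} → Apex p q c → Apex r s (to c)
    apex↦apex {c} (qc , cp) =
        subst (λ v → E v (to c)) (σ-maps (suc zero)) (Equivalence.to (σ-aut q c) qc)
      , subst (E (to c)) (σ-maps zero) (Equivalence.to (σ-aut c p) cp)

  apex-count-invariant : CHomogeneous D → ∀ {p q r s L₁ L₂} → E p q → E r s →
    Enumerates (Apex p q) L₁ → Enumerates (Apex r s) L₂ → length L₁ ≡ length L₂
  apex-count-invariant ch pq rs e₁ e₂ =
    enumeration-≡ e₁ e₂ (apex-↪ ch pq rs) (apex-↪ ch rs pq)

  module _ (lf : LocallyFinite D) where
    open LocallyFinite lf

    outs-enumerates : ∀ x → Enumerates (E x) (outs x)
    outs-enumerates x = record
      { unique   = outs-uniq x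
      ; sound    = Equivalence.to (outs-spec x _)
      ; complete = Equivalence.from (outs-spec x _)
      }

    ins-enumerates : ∀ x → Enumerates (λ z → E z x) (ins x)
    ins-enumerates x = record
      { unique   = ins-uniq x
      ; sound    = Equivalence.to (ins-spec x _)
      ; complete = Equivalence.from (ins-spec x _)
      }

    -- The apexes of an arc p → q are the out-neighbours of q lying in N⁻(p).
    ¬¬-apexes : ∀ p q → ¬ ¬ Σ (List V) (Enumerates (Apex p q))
    ¬¬-apexes p q = ¬¬-refine (outs-enumerates q) (λ c → E c p)

    -- A triangle x → y → z → x read from its out-neighbour y of x, and read
    -- from its in-neighbour z of x.
    rotate : ∀ {x} → Total (E x) (Apex x) ↪ Total (λ z → E z x) (λ z → Apex z x)
    rotate = swap , swap-injective , λ { {_ , _} (xy , yz , zx) → zx , xy , yz }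

    rotate⁻¹ : ∀ {x} → Total (λ z → E z x) (λ z → Apex z x) ↪ Total (E x) (Apex x)
    rotate⁻¹ = swap , swap-injective , λ { {_ , _} (zx , xy , yz) → xy , yz , zx }

    -- Double counting: with every arc on t ≥ 1 triangles, the triangles
    -- through x number d⁺(x)·t and d⁻(x)·t.
    balance-from-fibres : CHomogeneous D → ∀ {a b c Ref} x → E a b →
      Enumerates (Apex a b) Ref → c ∈ Ref →
      (outF : Fibres {Fibre = Apex x} (outs x)) →
      (inF : Fibres {Fibre = λ z → Apex z x} (ins x)) →
      outdeg D lf x ≡ indeg D lf x
    balance-from-fibres ch {Ref = Ref} x ab eRef c∈Ref outF inF =
      *-cancelʳ-≡ (outdeg D lf x) (indeg D lf x) t {{member⇒nonZero c∈Ref}} (begin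
        outdeg D lf x * t                   ≡⟨ sym out-count ⟩
        length (totalSpace (outs x) outF)   ≡⟨ same-count ⟩
        length (totalSpace (ins x) inF)     ≡⟨ in-count ⟩
        indeg D lf x * t                    ∎)
      where
      open ≡-Reasoning
      t = length Ref
      out-count : length (totalSpace (outs x) outF) ≡ outdeg D lf x * t
      out-count = totalSpace-length t (outs x) outF λ y∈ eK →
        apex-count-invariant ch (Enumerates.sound (outs-enumerates x) y∈) ab eK eRef
      in-count : length (totalSpace (ins x) inF) ≡ indeg D lf x * t
      in-count = totalSpace-length t (ins x) inF λ z∈ eK →
        apex-count-invariant ch (Enumerates.sound (ins-enumerates x) z∈) ab eK eRef
      same-count : length (totalSpace (outs x) outF) ≡ length (totalSpace (ins x) inF)
      same-count = enumeration-≡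
        (totalSpace-enumerates (outs-enumerates x) outF)
        (totalSpace-enumerates (ins-enumerates x) inF) rotate rotate⁻¹

    ¬¬-balance : CHomogeneous D → C₃Embeds D → ∀ x → ¬ ¬ (outdeg D lf x ≡ indeg D lf x)
    ¬¬-balance ch (a , b , c , ab , bc , ca) x =
      ¬¬-apexes a b >>= λ (Ref , eRef) →
      ¬¬-all (¬¬-apexes x) (outs x) >>= λ outF →
      ¬¬-all (λ z → ¬¬-apexes z x) (ins x) >>= λ inF →
      pure (balance-from-fibres ch x ab eRef (Enumerates.complete eRef (bc , ca)) outF inF)

lemma4p11 : (D : Digraph) → Connected D → (lf : LocallyFinite D) →
    CHomogeneous D → OutIndependent D → InIndependent D → C₃Embeds D →
    ∀ x → outdeg D lf x ≡ indeg D lf x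
lemma4p11 D _ lf ch _ _ c₃ x =
  decidable-stable (outdeg D lf x ≟ indeg D lf x) (¬¬-balance D lf ch c₃ x)
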